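{- The modal logic $\mathsf K$ is complete for finite provability models: if $A\in\mathcal L_\Box$ satisfies $\mathcal P,w\Vdash A$ for every provability model $\mathcal P$ with finitely many worlds and every world $w$ of $\mathcal P$, then $\mathsf K\vdash A$.
   Context: $\mathsf K$ is the smallest normal modal logic in $\mathcal L_\Box$. Language $\mathcal L_\Box$: formulas built from atomic propositions and $\bot$ using $\to$ and a unary $\Box$. A formula is purely modal if it is a Boolean combination of formulas of the form $\Box B$. A theory is a pair of a set of axioms and a set of inference rules (finitely many premises, one conclusion); $\mathsf T\vdash A$ means derivability from axioms by rules. A theory is classical if modus ponens is one of its rules and all classical tautologies are derivable. A provability pre-model is $\mathcal P=(W,\sqsubset,\{L_w\}_{w\in W^\sqsubset},V)$ with $W$ nonempty, $\sqsubset$ a binary relation on $W$, $V\subseteq W\times\mathrm{atoms}$, $W^\sqsubset=\{u:\exists v\,(v\sqsubset u)\}$, and a theory $L_w$ for each $w\in W^\sqsubset$. Satisfaction: atoms via $V$, $\bot$ never holds, $\to$ classical, $\mathcal P,w\Vdash\Box A$ iff $L_u\vdash A$ for all $u$ with $w\sqsubset u$. With $\sqsubset^+$ the transitive closure, $\mathcal P,w\Vdash^+A$ iff there is $u\sqsubset w$ with $\mathcal P,v\Vdash A$ for all $v$ such that $u\sqsubset^+v$. A provability model is a pre-model in which every $L_w$ is classical and which satisfies modal completeness: for every $w\in W^\sqsubset$ and purely modal $A$, $\mathcal P,w\Vdash^+A$ implies $L_w\vdash A$. -}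

module Defs where

open import Data.Nat using (ℕ)
open import Data.Bool using (Bool; true; false; not; _∨_)
open import Data.Fin using (Fin)
open import Data.List using (List; []; _∷_)
open import Data.List.Relation.Unary.All using (All)
open import Data.Product using (Σ; _×_; ∃)
open import Data.Sum using (_⊎_)
open import Data.Empty using (⊥)
open import Function.Bundles using (_↔_)
open import Relation.Binary.PropositionalEquality using (_≡_)
open import Relation.Binary.Construct.Closure.Transitive using (TransClosure)

infixr 5 _⇒_
data Fm : Set where
  atom : ℕ → Fm
  ⊥′   : Fm
  _⇒_  : Fm → Fm → Fm
  □_   : Fm → Fm

data PurelyModal : Fm → Set where
  pm-box : ∀ {B} → PurelyModal (□ B)
  pm-bot : PurelyModal ⊥′
  pm-imp : ∀ {A B} → PurelyModal A → PurelyModal B → PurelyModal (A ⇒ B)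

-- Classical tautologies: true under every Boolean valuation in which
-- atoms and boxed formulas are treated as propositional variables.
evalB : (ℕ → Bool) → (Fm → Bool) → Fm → Bool
evalB v b (atom p) = v p
evalB v b ⊥′       = false
evalB v b (A ⇒ B)  = not (evalB v b A) ∨ evalB v b B
evalB v b (□ A)    = b A

Tautology : Fm → Set
Tautology A = ∀ (v : ℕ → Bool) (b : Fm → Bool) → evalB v b A ≡ true

record Theory : Set₁ where
  field
    Axiom : Fm → Set
    Rule  : List Fm → Fm → Set
open Theory public

data _⊢_ (T : Theory) : Fm → Set where
  ax   : ∀ {A} → Axiom T A → T ⊢ A
  rule : ∀ {Γ A} → Rule T Γ A → All (T ⊢_) Γ → T ⊢ A

Classical : Theory → Set
Classical T = (∀ A B → Rule T (A ∷ (A ⇒ B) ∷ []) B)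
            × (∀ A → Tautology A → T ⊢ A)

data KAxiom : Fm → Set where
  k-taut : ∀ {A} → Tautology A → KAxiom A
  k-K    : ∀ A B → KAxiom (□ (A ⇒ B) ⇒ (□ A ⇒ □ B))

data KRule : List Fm → Fm → Set where
  k-mp  : ∀ A B → KRule (A ∷ (A ⇒ B) ∷ []) B
  k-nec : ∀ A → KRule (A ∷ []) (□ A)

K : Theory
K = record { Axiom = KAxiom ; Rule = KRule }

-- Provability pre-models.  L is given at every world, but only its values
-- on W^⊏ = {u | ∃ v. v ⊏ u} are ever used or constrained.
record PreModel : Set₁ where
  field
    W    : Set
    w₀   : W                       -- W nonempty
    _⊏_  : W → W → Set
    L    : W → Theory
    V    : W → ℕ → Set

  InDom : W → Set
  InDom u = ∃ λ v → v ⊏ u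

  _⊩_ : W → Fm → Set
  w ⊩ atom p  = V w p
  w ⊩ ⊥′      = ⊥
  w ⊩ (A ⇒ B) = w ⊩ A → w ⊩ B
  w ⊩ (□ A)   = ∀ u → w ⊏ u → L u ⊢ A

  _⊩⁺_ : W → Fm → Set
  w ⊩⁺ A = Σ W λ u → u ⊏ w × (∀ v → TransClosure _⊏_ u v → v ⊩ A)

open PreModel public

record IsProvabilityModel (P : PreModel) : Set where
  field
    classical : ∀ w → InDom P w → Classical (L P w)
    modal-completeness : ∀ w → InDom P w → ∀ A → PurelyModal A →
                         _⊩⁺_ P w A → L P w ⊢ A

FiniteWorlds : PreModel → Set
FiniteWorlds P = ∃ λ (n : ℕ) → W P ↔ Fin n

-- A finite tree of Boolean valuations is a finite provability model once every node
-- is given the theory of the formulas true at it, closed under modus ponens: such a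
-- theory contains all tautologies, and modal completeness holds for every formula A,
-- because w ⊩⁺ A already forces A at w itself. So it suffices to decide, for every
-- formula, whether K proves it or some finite tree refutes it. Bring the formula into
-- conjunctive normal form over the literals p, ¬p, □C and ¬□B. A clause with
-- both p and ¬p is a tautology; if K ⊢ B₁ → ⋯ → Bₖ → C for some □C of the clause,
-- where ¬□B₁, …, ¬□Bₖ are its negated boxes, necessitation and the K axiom prove the
-- clause. Otherwise each of these implications, having smaller modal depth, has a
-- refuting tree by recursion, and these trees are the children of a root refuting
-- the clause.

module Submission where

open import Defs
open import Data.Bool using (Bool; true; false; not; _∧_; _∨_)
open import Data.Bool.ListAction using (any; all)
open import Data.Bool.Properties using (∨-identityʳ; ∧-identityʳ; ∨-zeroʳ; ∧-zeroʳ; ∨-assoc; ∧-assoc; ∨-distribˡ-∧; ∨-distribʳ-∧; not-involutive)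
open import Data.Empty using (⊥)
open import Data.Fin using (Fin)
open import Data.List using (List; []; _∷_; [_]; _++_; map; foldr; length; lookup; mapMaybe; cartesianProductWith)
open import Data.List.Membership.Propositional using (_∈_; find)
open import Data.List.Membership.Propositional.Properties using (∈-++⁺ˡ; ∈-++⁺ʳ; ∈-++⁻; ∈-cartesianProductWith⁻; ∈-lookup)
open import Data.List.Relation.Unary.All as All using (All; []; _∷_)
import Data.List.Relation.Unary.All.Properties as All
open import Data.List.Relation.Unary.Any as Any using (Any; here; there; any?)
import Data.List.Relation.Unary.Any.Properties as Any
open import Data.Maybe using (Maybe; just; nothing)
open import Data.Nat using (ℕ; zero; suc; _≟_; _≤_; z≤n; s≤s⁻¹; _⊔_)
open import Data.Nat.Properties using (≤-refl; ⊔-lub; m⊔n≤o⇒m≤o; m⊔n≤o⇒n≤o)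
open import Data.List.Membership.DecPropositional _≟_ using (_∈?_)
open import Data.Product using (Σ; _×_; _,_; ∃)
open import Data.Sum using (_⊎_; inj₁; inj₂; swap)
open import Function using (_∘_)
open import Function.Construct.Identity using (↔-id)
open import Relation.Binary.Construct.Closure.Transitive using () renaming ([_] to [_]⁺)
open import Relation.Binary.PropositionalEquality using (_≡_; refl; sym; trans; cong; cong₂; subst; module ≡-Reasoning)
open import Relation.Nullary using (Dec; yes; no; does; contradiction)
open import Relation.Nullary.Decidable using (dec-true; dec-false)

module _ {A : Set} (f : A → Bool) where

  any-∈ : ∀ {x xs} → x ∈ xs → f x ≡ true → any f xs ≡ true
  any-∈ (here refl)       fx rewrite fx = refl
  any-∈ {xs = y ∷ _} (there x∈) fx rewrite any-∈ x∈ fx = ∨-zeroʳ (f y)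

  all-∈ : ∀ {x xs} → x ∈ xs → f x ≡ false → all f xs ≡ false
  all-∈ (here refl)       fx rewrite fx = refl
  all-∈ {xs = y ∷ _} (there x∈) fx rewrite all-∈ x∈ fx = ∧-zeroʳ (f y)

  any-++ : ∀ xs ys → any f (xs ++ ys) ≡ any f xs ∨ any f ys
  any-++ []       ys = refl
  any-++ (x ∷ xs) ys rewrite any-++ xs ys = sym (∨-assoc (f x) (any f xs) (any f ys))

  all-++ : ∀ xs ys → all f (xs ++ ys) ≡ all f xs ∧ all f ys
  all-++ []       ys = refl
  all-++ (x ∷ xs) ys rewrite all-++ xs ys = sym (∧-assoc (f x) (all f xs) (all f ys))

  all-true : ∀ {xs} → All (λ x → f x ≡ true) xs → all f xs ≡ true
  all-true []         = refl
  all-true (fx ∷ fxs) rewrite fx = all-true fxs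

  any-false : ∀ {xs} → All (λ x → f x ≡ false) xs → any f xs ≡ false
  any-false []         = refl
  any-false (fx ∷ fxs) rewrite fx = any-false fxs

module _ {A : Set} (f : A → Bool) where

  all-any-singleton : ∀ x → all (any f) [ [ x ] ] ≡ f x
  all-any-singleton x = trans (∧-identityʳ _) (∨-identityʳ (f x))

  all-any-prefixed : ∀ xs yss → all (any f) (map (xs ++_) yss) ≡ any f xs ∨ all (any f) yss
  all-any-prefixed xs []         = sym (∨-zeroʳ (any f xs))
  all-any-prefixed xs (ys ∷ yss) = begin
    any f (xs ++ ys) ∧ all (any f) (map (xs ++_) yss)
      ≡⟨ cong₂ _∧_ (any-++ f xs ys) (all-any-prefixed xs yss) ⟩
    (any f xs ∨ any f ys) ∧ (any f xs ∨ all (any f) yss)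
      ≡⟨ sym (∨-distribˡ-∧ (any f xs) (any f ys) (all (any f) yss)) ⟩
    any f xs ∨ (any f ys ∧ all (any f) yss) ∎
    where open ≡-Reasoning

  all-any-product : ∀ xss yss → all (any f) (cartesianProductWith _++_ xss yss) ≡
                                all (any f) xss ∨ all (any f) yss
  all-any-product []         yss = refl
  all-any-product (xs ∷ xss) yss = begin
    all (any f) (map (xs ++_) yss ++ cartesianProductWith _++_ xss yss)
      ≡⟨ all-++ (any f) (map (xs ++_) yss) _ ⟩
    all (any f) (map (xs ++_) yss) ∧ all (any f) (cartesianProductWith _++_ xss yss)
      ≡⟨ cong₂ _∧_ (all-any-prefixed xs yss) (all-any-product xss yss) ⟩
    (any f xs ∨ all (any f) yss) ∧ (all (any f) xss ∨ all (any f) yss)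
      ≡⟨ sym (∨-distribʳ-∧ (all (any f) yss) (any f xs) (all (any f) xss)) ⟩
    any f xs ∧ all (any f) xss ∨ all (any f) yss ∎
    where open ≡-Reasoning

module _ {A B : Set} (f : A → Maybe B) where

  ∈-mapMaybe⁺ : ∀ {x y xs} → x ∈ xs → f x ≡ just y → y ∈ mapMaybe f xs
  ∈-mapMaybe⁺ (here refl) fx rewrite fx = here refl
  ∈-mapMaybe⁺ {xs = x ∷ _} (there x∈) fx with f x
  ... | just _  = there (∈-mapMaybe⁺ x∈ fx)
  ... | nothing = ∈-mapMaybe⁺ x∈ fx

  ∈-mapMaybe⁻ : ∀ {y} xs → y ∈ mapMaybe f xs → ∃ λ x → x ∈ xs × f x ≡ just y
  ∈-mapMaybe⁻ (x ∷ xs) y∈ with f x in fx | y∈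
  ... | just _  | here refl = x , here refl , fx
  ... | just _  | there y∈′ = let x′ , x′∈ , fx′ = ∈-mapMaybe⁻ xs y∈′ in x′ , there x′∈ , fx′
  ... | nothing | y∈′       = let x′ , x′∈ , fx′ = ∈-mapMaybe⁻ xs y∈′ in x′ , there x′∈ , fx′

any-or-all : ∀ {A : Set} {P Q : A → Set} xs → (∀ {x} → x ∈ xs → P x ⊎ Q x) → Any P xs ⊎ All Q xs
any-or-all []       f = inj₂ []
any-or-all (x ∷ xs) f with f (here refl) | any-or-all xs (f ∘ there)
... | inj₁ px | _        = inj₁ (here px)
... | inj₂ qx | inj₁ pxs = inj₁ (there pxs)
... | inj₂ qx | inj₂ qxs = inj₂ (qx ∷ qxs)

imps : List Fm → Fm → Fm
imps Hs B = foldr _⇒_ B Hs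

module _ {v : ℕ → Bool} {b : Fm → Bool} where

  ⇒-intro : ∀ A B → (evalB v b A ≡ true → evalB v b B ≡ true) → evalB v b (A ⇒ B) ≡ true
  ⇒-intro A B f with evalB v b A
  ... | true  = f refl
  ... | false = refl

  ⇒-elim : ∀ A B → evalB v b (A ⇒ B) ≡ true → evalB v b A ≡ true → evalB v b B ≡ true
  ⇒-elim A B h a rewrite a = h

  imps-intro : ∀ Hs B → (All (λ H → evalB v b H ≡ true) Hs → evalB v b B ≡ true) →
               evalB v b (imps Hs B) ≡ true
  imps-intro []       B f = f []
  imps-intro (H ∷ Hs) B f = ⇒-intro H (imps Hs B) λ h → imps-intro Hs B (f ∘ (h ∷_))

  imps-cases : ∀ Hs B → evalB v b (imps Hs B) ≡ true →
               Any (λ H → evalB v b H ≡ false) Hs ⊎ evalB v b B ≡ true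
  imps-cases []       B h = inj₂ h
  imps-cases (H ∷ Hs) B h with evalB v b H in eq
  ... | false = inj₁ (here eq)
  ... | true  with imps-cases Hs B h
  ...   | inj₁ some = inj₁ (there some)
  ...   | inj₂ hB   = inj₂ hB

  imps-false : ∀ Hs B → evalB v b (imps Hs B) ≡ false →
               All (λ H → evalB v b H ≡ true) Hs × evalB v b B ≡ false
  imps-false []       B h = [] , h
  imps-false (H ∷ Hs) B h with evalB v b H in eq
  ... | true = let hs , hB = imps-false Hs B h in eq ∷ hs , hB
  imps-false (H ∷ Hs) B () | false

mp : ∀ {A B} → K ⊢ A → K ⊢ (A ⇒ B) → K ⊢ B
mp {A} {B} ⊢A ⊢A⇒B = rule (k-mp A B) (⊢A ∷ ⊢A⇒B ∷ [])

mp* : ∀ {Hs B} → All (K ⊢_) Hs → K ⊢ imps Hs B → K ⊢ B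
mp* []          ⊢B = ⊢B
mp* (⊢H ∷ ⊢Hs) ⊢H⇒B = mp* ⊢Hs (mp ⊢H ⊢H⇒B)

Entails : List Fm → Fm → Set
Entails Hs B = ∀ v b → All (λ H → evalB v b H ≡ true) Hs → evalB v b B ≡ true

⊢-entailed : ∀ {Hs B} → All (K ⊢_) Hs → Entails Hs B → K ⊢ B
⊢-entailed {Hs} {B} ⊢Hs Hs⊨B = mp* ⊢Hs (ax (k-taut λ v b → imps-intro Hs B (Hs⊨B v b)))

□-imps : ∀ Bs C → K ⊢ (□ (imps Bs C) ⇒ imps (map □_ Bs) (□ C))
□-imps []       C = ⊢-entailed [] λ v b _ → ⇒-intro {v} {b} (□ C) (□ C) λ h → h
□-imps (B ∷ Bs) C = ⊢-entailed (ax (k-K B (imps Bs C)) ∷ □-imps Bs C ∷ []) syllogism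
  where
  X Y Z U : Fm
  X = □ (B ⇒ imps Bs C)
  Y = □ B
  Z = □ (imps Bs C)
  U = imps (map □_ Bs) (□ C)
  syllogism : Entails ((X ⇒ Y ⇒ Z) ∷ (Z ⇒ U) ∷ []) (X ⇒ Y ⇒ U)
  syllogism v b (distribution ∷ ih ∷ []) =
    ⇒-intro {v} {b} X (Y ⇒ U) λ x → ⇒-intro {v} {b} Y U λ y →
      ⇒-elim {v} {b} Z U ih (⇒-elim {v} {b} Y Z (⇒-elim {v} {b} X (Y ⇒ Z) distribution x) y)

nec-imps : ∀ {Bs C} → K ⊢ imps Bs C → K ⊢ imps (map □_ Bs) (□ C)
nec-imps {Bs} {C} ⊢imps = mp (rule (k-nec _) (⊢imps ∷ [])) (□-imps Bs C)

-- Conjunctive normal form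

data Literal : Set where
  atom⁺ atom⁻ : ℕ → Literal
  box⁺ box⁻   : Fm → Literal

Clause : Set
Clause = List Literal

literal : (ℕ → Bool) → (Fm → Bool) → Literal → Bool
literal v b (atom⁺ p) = v p
literal v b (atom⁻ p) = not (v p)
literal v b (box⁺ C)  = b C
literal v b (box⁻ B)  = not (b B)

⌜_⌝ : Literal → Fm
⌜ atom⁺ p ⌝ = atom p
⌜ atom⁻ p ⌝ = atom p ⇒ ⊥′
⌜ box⁺ C ⌝  = □ C
⌜ box⁻ B ⌝  = □ B ⇒ ⊥′

⋁ : Clause → Fm
⋁ = foldr (λ l D → (⌜ l ⌝ ⇒ ⊥′) ⇒ D) ⊥′

mutual
  cnf : Fm → List Clause
  cnf (atom p) = [ [ atom⁺ p ] ]
  cnf ⊥′       = [ [] ]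
  cnf (A ⇒ B)  = cartesianProductWith _++_ (cnf⁻ A) (cnf B)
  cnf (□ C)    = [ [ box⁺ C ] ]

  -- a conjunctive normal form of the negation
  cnf⁻ : Fm → List Clause
  cnf⁻ (atom p) = [ [ atom⁻ p ] ]
  cnf⁻ ⊥′       = []
  cnf⁻ (A ⇒ B)  = cnf A ++ cnf⁻ B
  cnf⁻ (□ B)    = [ [ box⁻ B ] ]

module _ (v : ℕ → Bool) (b : Fm → Bool) where

  evalB-⌜⌝ : ∀ l → evalB v b ⌜ l ⌝ ≡ literal v b l
  evalB-⌜⌝ (atom⁺ p) = refl
  evalB-⌜⌝ (atom⁻ p) = ∨-identityʳ (not (v p))
  evalB-⌜⌝ (box⁺ C)  = refl
  evalB-⌜⌝ (box⁻ B)  = ∨-identityʳ (not (b B))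

  evalB-⋁ : ∀ c → evalB v b (⋁ c) ≡ any (literal v b) c
  evalB-⋁ []      = refl
  evalB-⋁ (l ∷ c) = cong₂ _∨_ double-negation (evalB-⋁ c)
    where
    double-negation : not (not (evalB v b ⌜ l ⌝) ∨ false) ≡ literal v b l
    double-negation = trans (cong not (∨-identityʳ _)) (trans (not-involutive _) (evalB-⌜⌝ l))

  mutual
    evalB-cnf : ∀ A → evalB v b A ≡ all (any (literal v b)) (cnf A)
    evalB-cnf (atom p) = sym (all-any-singleton (literal v b) (atom⁺ p))
    evalB-cnf ⊥′       = refl
    evalB-cnf (A ⇒ B)  = trans (cong₂ _∨_ (evalB-cnf⁻ A) (evalB-cnf B))
                               (sym (all-any-product (literal v b) (cnf⁻ A) (cnf B)))
    evalB-cnf (□ C)    = sym (all-any-singleton (literal v b) (box⁺ C))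

    evalB-cnf⁻ : ∀ A → not (evalB v b A) ≡ all (any (literal v b)) (cnf⁻ A)
    evalB-cnf⁻ (atom p) = sym (all-any-singleton (literal v b) (atom⁻ p))
    evalB-cnf⁻ ⊥′       = refl
    evalB-cnf⁻ (A ⇒ B)  = begin
      not (not (evalB v b A) ∨ evalB v b B)  ≡⟨ de-morgan (evalB v b A) (evalB v b B) ⟩
      evalB v b A ∧ not (evalB v b B)        ≡⟨ cong₂ _∧_ (evalB-cnf A) (evalB-cnf⁻ B) ⟩
      all (any (literal v b)) (cnf A) ∧ all (any (literal v b)) (cnf⁻ B)
                                             ≡⟨ sym (all-++ (any (literal v b)) (cnf A) (cnf⁻ B)) ⟩
      all (any (literal v b)) (cnf A ++ cnf⁻ B) ∎
      where
      open ≡-Reasoning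
      de-morgan : ∀ x y → not (not x ∨ y) ≡ x ∧ not y
      de-morgan true  y = refl
      de-morgan false y = refl
    evalB-cnf⁻ (□ B)    = sym (all-any-singleton (literal v b) (box⁻ B))

depth : Fm → ℕ
depth (atom p) = 0
depth ⊥′       = 0
depth (A ⇒ B)  = depth A ⊔ depth B
depth (□ A)    = suc (depth A)

depthˡ : Literal → ℕ
depthˡ (atom⁺ p) = 0
depthˡ (atom⁻ p) = 0
depthˡ (box⁺ C)  = suc (depth C)
depthˡ (box⁻ B)  = suc (depth B)

depth-imps : ∀ {n} Bs C → All (λ B → depth B ≤ n) Bs → depth C ≤ n → depth (imps Bs C) ≤ n
depth-imps []       C []         C≤n = C≤n
depth-imps (B ∷ Bs) C (B≤n ∷ Bs≤n) C≤n = ⊔-lub B≤n (depth-imps Bs C Bs≤n C≤n)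

mutual
  depth-cnf : ∀ {n} A → depth A ≤ n → ∀ {c l} → c ∈ cnf A → l ∈ c → depthˡ l ≤ n
  depth-cnf (atom p) A≤n (here refl) (here refl) = z≤n
  depth-cnf ⊥′       A≤n (here refl) ()
  depth-cnf (A ⇒ B)  A⇒B≤n c∈ l∈
    with c₁ , c₂ , c₁∈ , c₂∈ , refl ← ∈-cartesianProductWith⁻ _++_ (cnf⁻ A) (cnf B) c∈
    with ∈-++⁻ c₁ l∈
  ... | inj₁ l∈c₁ = depth-cnf⁻ A (m⊔n≤o⇒m≤o (depth A) (depth B) A⇒B≤n) c₁∈ l∈c₁
  ... | inj₂ l∈c₂ = depth-cnf B (m⊔n≤o⇒n≤o (depth A) (depth B) A⇒B≤n) c₂∈ l∈c₂
  depth-cnf (□ C)    C≤n (here refl) (here refl) = C≤n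

  depth-cnf⁻ : ∀ {n} A → depth A ≤ n → ∀ {c l} → c ∈ cnf⁻ A → l ∈ c → depthˡ l ≤ n
  depth-cnf⁻ (atom p) A≤n (here refl) (here refl) = z≤n
  depth-cnf⁻ (A ⇒ B)  A⇒B≤n c∈ l∈ with ∈-++⁻ (cnf A) c∈
  ... | inj₁ c∈A = depth-cnf A (m⊔n≤o⇒m≤o (depth A) (depth B) A⇒B≤n) c∈A l∈
  ... | inj₂ c∈B = depth-cnf⁻ B (m⊔n≤o⇒n≤o (depth A) (depth B) A⇒B≤n) c∈B l∈
  depth-cnf⁻ (□ B)    B≤n (here refl) (here refl) = B≤n

data Tree : Set where
  node : (ℕ → Bool) → List Tree → Tree

valuation : Tree → ℕ → Bool
valuation (node v _) = v

children : Tree → List Tree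
children (node _ ts) = ts

infix 4.5 _⊨_ _⊨all_ _⊨ˡ_

mutual
  _⊨_ : Tree → Fm → Bool
  t ⊨ A = evalB (valuation t) (□-valuation t) A

  □-valuation : Tree → Fm → Bool
  □-valuation (node _ ts) B = ts ⊨all B

  _⊨all_ : List Tree → Fm → Bool
  []       ⊨all B = true
  (t ∷ ts) ⊨all B = (t ⊨ B) ∧ (ts ⊨all B)

_⊨ˡ_ : Tree → Literal → Bool
t ⊨ˡ l = literal (valuation t) (□-valuation t) l

⊨all⇒All : ∀ ts {B} → ts ⊨all B ≡ true → All (λ t → t ⊨ B ≡ true) ts
⊨all⇒All []           h = []
⊨all⇒All (t ∷ ts) {B} h with t ⊨ B in t⊨B
... | true = t⊨B ∷ ⊨all⇒All ts h
⊨all⇒All (t ∷ ts) () | false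

All⇒⊨all : ∀ {ts B} → All (λ t → t ⊨ B ≡ true) ts → ts ⊨all B ≡ true
All⇒⊨all []                         = refl
All⇒⊨all (t⊨B ∷ ts⊨B) rewrite t⊨B = All⇒⊨all ts⊨B

□-true⇒ : ∀ t {B} → t ⊨ □ B ≡ true → All (λ c → c ⊨ B ≡ true) (children t)
□-true⇒ (node v ts) = ⊨all⇒All ts

□-true⇐ : ∀ t {B} → All (λ c → c ⊨ B ≡ true) (children t) → t ⊨ □ B ≡ true
□-true⇐ (node v ts) = All⇒⊨all

Refutation : Fm → Set
Refutation A = Σ Tree λ t → t ⊨ A ≡ false

Decision : Fm → Set
Decision A = K ⊢ A ⊎ Refutation A

-- Deciding K

negAtom : Literal → Maybe ℕ
negAtom (atom⁻ p) = just p
negAtom _         = nothing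

posBox negBox : Literal → Maybe Fm
posBox (box⁺ C) = just C
posBox _        = nothing
negBox (box⁻ B) = just B
negBox _        = nothing

negAtoms : Clause → List ℕ
negAtoms = mapMaybe negAtom

posBoxes negBoxes : Clause → List Fm
posBoxes = mapMaybe posBox
negBoxes = mapMaybe negBox

∈-negAtoms⁻ : ∀ c {p} → p ∈ negAtoms c → atom⁻ p ∈ c
∈-negAtoms⁻ c p∈ with ∈-mapMaybe⁻ negAtom c p∈
... | atom⁻ _ , l∈ , refl = l∈

∈-posBoxes⁻ : ∀ c {C} → C ∈ posBoxes c → box⁺ C ∈ c
∈-posBoxes⁻ c C∈ with ∈-mapMaybe⁻ posBox c C∈
... | box⁺ _ , l∈ , refl = l∈

∈-negBoxes⁻ : ∀ c {B} → B ∈ negBoxes c → box⁻ B ∈ c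
∈-negBoxes⁻ c B∈ with ∈-mapMaybe⁻ negBox c B∈
... | box⁻ _ , l∈ , refl = l∈

Clashes : List ℕ → Literal → Set
Clashes ps (atom⁺ p) = p ∈ ps
Clashes ps _         = ⊥

clashes? : ∀ ps l → Dec (Clashes ps l)
clashes? ps (atom⁺ p) = p ∈? ps
clashes? ps (atom⁻ p) = no λ ()
clashes? ps (box⁺ C)  = no λ ()
clashes? ps (box⁻ B)  = no λ ()

⊢-clashing : ∀ c → Any (Clashes (negAtoms c)) c → K ⊢ ⋁ c
⊢-clashing c clash with find clash
... | atom⁺ p , p⁺∈ , p∈ = ⊢-entailed [] λ v b _ → trans (evalB-⋁ v b c) (excluded-middle v b)
  where
  excluded-middle : ∀ v b → any (literal v b) c ≡ true
  excluded-middle v b with v p in vp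
  ... | true  = any-∈ (literal v b) p⁺∈ vp
  ... | false = any-∈ (literal v b) (∈-negAtoms⁻ c p∈) (cong not vp)

⊢-boxed : ∀ c {C} → C ∈ posBoxes c → K ⊢ imps (negBoxes c) C → K ⊢ ⋁ c
⊢-boxed c {C} C∈ ⊢imps =
  ⊢-entailed (nec-imps {negBoxes c} {C} ⊢imps ∷ [])
    λ { v b (h ∷ []) → trans (evalB-⋁ v b c) (true-literal v b h) }
  where
  true-literal : ∀ v b → evalB v b (imps (map □_ (negBoxes c)) (□ C)) ≡ true →
                 any (literal v b) c ≡ true
  true-literal v b h with imps-cases (map □_ (negBoxes c)) (□ C) h
  ... | inj₂ □C = any-∈ (literal v b) (∈-posBoxes⁻ c C∈) □C
  ... | inj₁ □B-false with find (Any.map⁻ □B-false)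
  ...   | B , B∈ , □B = any-∈ (literal v b) (∈-negBoxes⁻ c B∈) (cong not □B)

gather-refutations : ∀ Bs Cs → All (λ C → Refutation (imps Bs C)) Cs →
  Σ (List Tree) λ ts → All (λ B → ts ⊨all B ≡ true) Bs × All (λ C → ts ⊨all C ≡ false) Cs
gather-refutations Bs []                  []         = [] , All.universal (λ _ → refl) Bs , []
gather-refutations Bs (C ∷ Cs) ((t , t⊭) ∷ refutations)
  with gather-refutations Bs Cs refutations | imps-false Bs C t⊭
... | ts , ts⊨Bs , ts⊭Cs | t⊨Bs , t⊭C =
  t ∷ ts , All.zipWith (λ (t⊨B , ts⊨B) → cong₂ _∧_ t⊨B ts⊨B) (t⊨Bs , ts⊨Bs)
         , cong (_∧ (ts ⊨all C)) t⊭C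
         ∷ All.map (λ ts⊭ → trans (cong (_ ∧_) ts⊭) (∧-zeroʳ _)) ts⊭Cs

ClauseRefutation : Clause → Set
ClauseRefutation c = Σ Tree λ t → any (t ⊨ˡ_) c ≡ false

decide-clause : ∀ c → (∀ {C} → C ∈ posBoxes c → Decision (imps (negBoxes c) C)) →
                K ⊢ ⋁ c ⊎ ClauseRefutation c
decide-clause c decide-box with any-or-all (posBoxes c) decide-box
... | inj₁ provable = let C , C∈ , ⊢imps = find provable in inj₁ (⊢-boxed c C∈ ⊢imps)
... | inj₂ refutations with any? (clashes? (negAtoms c)) c
...   | yes clash = inj₁ (⊢-clashing c clash)
...   | no no-clash with gather-refutations (negBoxes c) (posBoxes c) refutations
...     | ts , ts⊨Bs , ts⊭Cs = inj₂ (root , any-false (root ⊨ˡ_) (All.tabulate refuted))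
  where
  root : Tree
  root = node (λ p → does (p ∈? negAtoms c)) ts
  refuted : ∀ {l} → l ∈ c → root ⊨ˡ l ≡ false
  refuted {atom⁺ p} l∈ =
    dec-false (p ∈? negAtoms c) λ p∈ → no-clash (Any.map (λ { refl → p∈ }) l∈)
  refuted {atom⁻ p} l∈ = cong not (dec-true (p ∈? negAtoms c) (∈-mapMaybe⁺ negAtom l∈ refl))
  refuted {box⁺ C}  l∈ = All.lookup ts⊭Cs (∈-mapMaybe⁺ posBox l∈ refl)
  refuted {box⁻ B}  l∈ = cong not (All.lookup ts⊨Bs (∈-mapMaybe⁺ negBox l∈ refl))

mutual
  decide : ∀ n A → depth A ≤ n → Decision A
  decide n A A≤n with any-or-all (cnf A) (decide-cnf n A A≤n)
  ... | inj₁ refuted-clause =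
    let c , c∈ , t , t⊭c = find refuted-clause
    in inj₂ (t , trans (evalB-cnf (valuation t) (□-valuation t) A) (all-∈ (any (t ⊨ˡ_)) c∈ t⊭c))
  ... | inj₂ ⊢clauses = inj₁ (⊢-entailed (All.map⁺ ⊢clauses) cnf-entails)
    where
    cnf-entails : Entails (map ⋁ (cnf A)) A
    cnf-entails v b ⊨clauses = trans (evalB-cnf v b A)
      (all-true (any (literal v b))
        (All.map (λ {c} ⊨c → trans (sym (evalB-⋁ v b c)) ⊨c) (All.map⁻ ⊨clauses)))

  decide-cnf : ∀ n A → depth A ≤ n → ∀ {c} → c ∈ cnf A → ClauseRefutation c ⊎ K ⊢ ⋁ c
  decide-cnf n A A≤n {c} c∈ = swap (decide-clause c (decide-box n (depth-cnf A A≤n c∈)))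

  decide-box : ∀ n {c} → (∀ {l} → l ∈ c → depthˡ l ≤ n) →
               ∀ {C} → C ∈ posBoxes c → Decision (imps (negBoxes c) C)
  decide-box zero    {c} c≤0 C∈ with () ← c≤0 (∈-posBoxes⁻ c C∈)
  decide-box (suc m) {c} c≤n {C} C∈ =
    decide m (imps (negBoxes c) C)
      (depth-imps (negBoxes c) C (All.tabulate (λ B∈ → s≤s⁻¹ (c≤n (∈-negBoxes⁻ c B∈))))
                                 (s≤s⁻¹ (c≤n (∈-posBoxes⁻ c C∈))))

-- Trees as provability models

mutual
  subtrees : Tree → List Tree
  subtrees (node v ts) = node v ts ∷ subtrees* ts

  subtrees* : List Tree → List Tree
  subtrees* []       = []
  subtrees* (t ∷ ts) = subtrees t ++ subtrees* ts

root∈subtrees : ∀ t → t ∈ subtrees t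
root∈subtrees (node v ts) = here refl

∈-subtrees* : ∀ {t} ts → t ∈ ts → t ∈ subtrees* ts
∈-subtrees* (t ∷ ts) (here refl) = ∈-++⁺ˡ (root∈subtrees t)
∈-subtrees* (t ∷ ts) (there t∈)  = ∈-++⁺ʳ (subtrees t) (∈-subtrees* ts t∈)

mutual
  subtrees-closed : ∀ t {s c} → s ∈ subtrees t → c ∈ children s → c ∈ subtrees t
  subtrees-closed (node v ts) (here refl) c∈ = there (∈-subtrees* ts c∈)
  subtrees-closed (node v ts) (there s∈)  c∈ = there (subtrees*-closed ts s∈ c∈)

  subtrees*-closed : ∀ ts {s c} → s ∈ subtrees* ts → c ∈ children s → c ∈ subtrees* ts
  subtrees*-closed (t ∷ ts) s∈ c∈ with ∈-++⁻ (subtrees t) s∈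
  ... | inj₁ s∈t  = ∈-++⁺ˡ (subtrees-closed t s∈t c∈)
  ... | inj₂ s∈ts = ∈-++⁺ʳ (subtrees t) (subtrees*-closed ts s∈ts c∈)

data ModusPonens : List Fm → Fm → Set where
  modus-ponens : ∀ A B → ModusPonens (A ∷ (A ⇒ B) ∷ []) B

theory : Tree → Theory
theory t = record { Axiom = λ A → t ⊨ A ≡ true ; Rule = ModusPonens }

theory-sound : ∀ t {A} → theory t ⊢ A → t ⊨ A ≡ true
theory-sound t (ax t⊨A) = t⊨A
theory-sound t (rule (modus-ponens A B) (⊢A ∷ ⊢A⇒B ∷ [])) =
  ⇒-elim A B (theory-sound t ⊢A⇒B) (theory-sound t ⊢A)

theory-classical : ∀ t → Classical (theory t)
theory-classical t = modus-ponens , λ A taut → ax (taut (valuation t) (□-valuation t))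

module TreeModel (r : Tree) where

  worlds : List Tree
  worlds = subtrees r

  world : Fin (length worlds) → Tree
  world = lookup worlds

  root : Fin (length worlds)
  root = Any.index (root∈subtrees r)

  model : PreModel
  model = record
    { W   = Fin (length worlds)
    ; w₀  = root
    ; _⊏_ = λ i j → world j ∈ children (world i)
    ; L   = λ i → theory (world i)
    ; V   = λ i p → valuation (world i) p ≡ true
    }

  mutual
    ⊨⇒⊩ : ∀ i A → world i ⊨ A ≡ true → _⊩_ model i A
    ⊨⇒⊩ i (atom p) h      = h
    ⊨⇒⊩ i ⊥′       ()
    ⊨⇒⊩ i (A ⇒ B)  h ⊩A   = ⊨⇒⊩ i B (⇒-elim A B h (⊩⇒⊨ i A ⊩A))
    ⊨⇒⊩ i (□ B)    h j j∈ = ax (All.lookup (□-true⇒ (world i) h) j∈)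

    ⊩⇒⊨ : ∀ i A → _⊩_ model i A → world i ⊨ A ≡ true
    ⊩⇒⊨ i (atom p) h = h
    ⊩⇒⊨ i ⊥′       ()
    ⊩⇒⊨ i (A ⇒ B)  h = ⇒-intro A B λ ⊨A → ⊩⇒⊨ i B (h (⊨⇒⊩ i A ⊨A))
    ⊩⇒⊨ i (□ B)    h = □-true⇐ (world i) (All.tabulate child⊨B)
      where
      child⊨B : ∀ {c} → c ∈ children (world i) → c ⊨ B ≡ true
      child⊨B {c} c∈ = subst (λ t → t ⊨ B ≡ true) (sym c≡world-j)
                         (theory-sound (world j) (h j (subst (_∈ children (world i)) c≡world-j c∈)))
        where
        c∈worlds : c ∈ worlds
        c∈worlds = subtrees-closed r (∈-lookup i) c∈
        j : Fin (length worlds)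
        j = Any.index c∈worlds
        c≡world-j : c ≡ world j
        c≡world-j = Any.lookup-index c∈worlds

  is-provability-model : IsProvabilityModel model
  is-provability-model = record
    { classical          = λ i _ → theory-classical (world i)
    ; modal-completeness = λ i _ A _ (u , u⊏i , ⊩A) → ax (⊩⇒⊨ i A (⊩A i [ u⊏i ]⁺))
    }

  finite : FiniteWorlds model
  finite = length worlds , ↔-id _

  root-world : world root ≡ r
  root-world = sym (Any.lookup-index (root∈subtrees r))

FinitelyValid : Fm → Set₁
FinitelyValid A = (P : PreModel) → IsProvabilityModel P → FiniteWorlds P → (w : W P) → _⊩_ P w A

finitely-valid⇒tree-valid : ∀ A → FinitelyValid A → ∀ t → t ⊨ A ≡ true
finitely-valid⇒tree-valid A valid t =
  subst (λ r → r ⊨ A ≡ true) root-world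
    (⊩⇒⊨ root A (valid model is-provability-model finite root))
  where open TreeModel t

tree-complete : ∀ A → (∀ t → t ⊨ A ≡ true) → K ⊢ A
tree-complete A tree-valid with decide (depth A) A ≤-refl
... | inj₁ ⊢A       = ⊢A
... | inj₂ (t , t⊭A) = contradiction (trans (sym (tree-valid t)) t⊭A) λ ()

theorem3p7 : (A : Fm) →
    ((P : PreModel) → IsProvabilityModel P → FiniteWorlds P →
      (w : W P) → _⊩_ P w A) →
    K ⊢ A
theorem3p7 A valid = tree-complete A (finitely-valid⇒tree-valid A valid)
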